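{- Let $G=(V,E)$ be a graph with $n$ vertices and minimum degree $r$, and let $k$ be an integer with $0\le k\le n$. Then the optimal value $\mathrm{opt}$ of \textsc{max $(k,n-k)$-cut} on $G$ satisfies $\mathrm{opt}\ge\min\{n-k,rk\}$.
   Context: The optimal value of \textsc{max $(k,n-k)$-cut} on $G$ is the maximum, over all $V'\subseteq V$ with $|V'|=k$, of the number of edges with exactly one endpoint in $V'$. -}

module Defs where

open import Data.Nat using (ℕ; _+_; _<_)
open import Data.Bool using (Bool; true; false; T; not; _xor_; _∧_)
open import Data.Fin using (Fin; toℕ)
open import Data.Fin.Subset using (Subset; _∈_; ∣_∣)
open import Data.Vec using (lookup)
open import Data.List using (List; length; filter; allFin; concatMap; map)
open import Data.Product using (_×_; _,_; Σ; ∃)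
open import Relation.Nullary using (¬_)
open import Relation.Binary.PropositionalEquality using (_≡_)
open import Data.Fin.Properties using (_<?_)
open import Relation.Nullary.Decidable using (⌊_⌋)
open import Data.Bool.Properties using (T?)

record Graph (n : ℕ) : Set where
  field
    adj       : Fin n → Fin n → Bool
    symmetric : ∀ u v → adj u v ≡ adj v u
    loopless  : ∀ v → adj v v ≡ false
open Graph public

degree : ∀ {n} → Graph n → Fin n → ℕ
degree G v = length (filter (λ u → T? (adj G v u)) (allFin _))

-- G has minimum degree r: every vertex has degree ≥ r and some vertex attains r
-- (for n = 0 there are no vertices; we then only require the vacuous lower bound)
HasMinDegree : ∀ {n} → Graph n → ℕ → Set
HasMinDegree {n} G r =
  (∀ v → r Data.Nat.≤ degree G v) × (Fin n → ∃ λ v → degree G v ≡ r)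

-- all vertex pairs (u , v) with u < v, i.e. each unordered pair once
orderedPairs : ∀ n → List (Fin n × Fin n)
orderedPairs n =
  concatMap (λ u → map (λ v → (u , v)) (filter (λ v → u <? v) (allFin n))) (allFin n)

cutSize : ∀ {n} → Graph n → Subset n → ℕ
cutSize {n} G S =
  length (filter (λ { (u , v) → T? (adj G u v ∧ (lookup S u xor lookup S v)) })
                 (orderedPairs n))

-- opt of max (k, n-k)-cut is at least m: some k-subset has cut size ≥ m
-- (opt is a maximum over a finite nonempty set when k ≤ n, so "opt ≥ m" is
-- equivalent to the existence of a witness attaining ≥ m)
OptAtLeast : ∀ {n} → Graph n → ℕ → ℕ → Set
OptAtLeast {n} G k m = Σ (Subset n) λ S → (∣ S ∣ ≡ k) × (m Data.Nat.≤ cutSize G S)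

-- Grow an independent set greedily, adding at each step a vertex that has no
-- neighbour in the set. If it reaches k vertices, each of them has at least r
-- neighbours, all outside the set, so at least r k edges leave it. Otherwise the
-- process stops at a maximal independent set of fewer than k vertices; such a set
-- dominates, and so does any superset of it, so enlarging it to k vertices gives a
-- set each of whose n - k outside vertices sends an edge into it.

module Submission where

open import Defs
open import Data.Nat using (ℕ; _≤_; _∸_; _*_; _⊓_)
open import Data.Nat.Base using (zero; suc; _+_; z≤n; s≤s)
open import Data.Nat.Properties
  using ( +-*-semiring; ≤-refl; ≤-trans; ≤-reflexive; +-mono-≤; m≤m+n; m≤n+m
        ; *-distribˡ-+; *-zeroʳ; *-identityˡ; *-identityʳ; +-identityʳ
        ; m≤n⇒m<n∨m≡n; m≤n⇒m≤1+n; <⇒≤; n≤0⇒n≡0; <⇒≱; m⊓n≤m; m⊓n≤n; module ≤-Reasoning)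
import Data.Nat.ListAction as List
open import Data.Nat.ListAction.Properties using (sum-++)
open import Data.Bool using (Bool; true; false; not; _∧_; _xor_)
open import Data.Bool.Properties using (T?; ¬-not) renaming (_≟_ to _≟ᵇ_)
open import Data.Fin using (Fin) renaming (zero to 0F; suc to 1+)
open import Data.Fin.Properties using (_<?_; <-cmp; any?)
open import Data.Fin.Subset using (Subset; _∈_; _∉_; _⊆_; ∣_∣; ∁; ⁅_⁆; _∪_; ⊤; ⊥; inside; outside)
open import Data.Fin.Subset.Properties
  using (_∈?_; ∉⊥; ∣⊥∣≡0; ∣⊤∣≡n; ∣∁p∣≡n∸∣p∣; p⊆q⇒∣p∣≤∣q∣; p⊆p∪q; x∈p∪q⁻; x∈⁅y⁆⇒x≡y; ∪-identityʳ)
open import Data.Vec using (lookup; here; there)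
import Data.Vec as V
open import Data.Vec.Properties using (lookup⇒[]=; []=⇒lookup; lookup-map)
open import Data.List using (List; []; _∷_; filter; allFin; tabulate; concatMap; map)
import Data.List as L
open import Data.List.Properties using (map-++; map-∘)
open import Data.Product using (_×_; _,_; ∃-syntax)
open import Data.Sum using (_⊎_; inj₁; inj₂)
open import Relation.Binary using (tri<; tri≈; tri>)
open import Relation.Nullary using (¬_; does; yes; no; ¬?; _×-dec_; contradiction)
open import Relation.Nullary.Decidable using (dec-true; decidable-stable)
open import Relation.Unary using (Pred; Decidable)
open import Function using (id; _∘_)
open import Relation.Binary.PropositionalEquality
  using (_≡_; refl; sym; trans; cong; cong₂; module ≡-Reasoning)
open import Algebra.Properties.Semiring.Sum +-*-semiring
  using (sum-syntax; ∑-distrib-+; ∑-comm; *-distribˡ-sum; sum-cong-≗)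

χ : Bool → ℕ
χ true  = 1
χ false = 0

χ≤1 : ∀ b → χ b ≤ 1
χ≤1 true  = ≤-refl
χ≤1 false = z≤n

χ-cut : ∀ s t a → χ (s ∧ not t ∧ a) + χ (t ∧ not s ∧ a) ≡ χ (a ∧ (s xor t))
χ-cut true  true  true  = refl
χ-cut true  true  false = refl
χ-cut true  false true  = refl
χ-cut true  false false = refl
χ-cut false true  true  = refl
χ-cut false true  false = refl
χ-cut false false true  = refl
χ-cut false false false = refl

∑-mono-≤ : ∀ {n} {f g : Fin n → ℕ} → (∀ i → f i ≤ g i) → ∑[ i < n ] f i ≤ ∑[ i < n ] g i
∑-mono-≤ {zero}  f≤g = z≤n
∑-mono-≤ {suc n} f≤g = +-mono-≤ (f≤g 0F) (∑-mono-≤ (f≤g ∘ 1+))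

term≤sum : ∀ {n} (f : Fin n → ℕ) i → f i ≤ ∑[ j < n ] f j
term≤sum f 0F     = m≤m+n _ _
term≤sum f (1+ i) = ≤-trans (term≤sum (λ j → f (1+ j)) i) (m≤n+m _ _)

∑∑≤∑∑-upperTriangle : ∀ {n} (f : Fin n → Fin n → ℕ) → (∀ i → f i i ≡ 0) →
  ∑[ i < n ] ∑[ j < n ] f i j ≤ ∑[ i < n ] ∑[ j < n ] (χ (does (i <? j)) * (f i j + f j i))
∑∑≤∑∑-upperTriangle {n} f diag = begin
  ∑[ i < n ] ∑[ j < n ] f i j
    ≤⟨ ∑-mono-≤ (λ i → ∑-mono-≤ (split-by-order i)) ⟩
  ∑[ i < n ] ∑[ j < n ] (χ< i j * f i j + χ< j i * f i j)
    ≡⟨ sum-cong-≗ (λ i → ∑-distrib-+ (λ j → χ< i j * f i j) (λ j → χ< j i * f i j)) ⟩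
  ∑[ i < n ] (∑[ j < n ] (χ< i j * f i j) + ∑[ j < n ] (χ< j i * f i j))
    ≡⟨ ∑-distrib-+ (λ i → ∑[ j < n ] (χ< i j * f i j)) (λ i → ∑[ j < n ] (χ< j i * f i j)) ⟩
  ∑[ i < n ] ∑[ j < n ] (χ< i j * f i j) + ∑[ i < n ] ∑[ j < n ] (χ< j i * f i j)
    ≡⟨ cong (∑[ i < n ] ∑[ j < n ] (χ< i j * f i j) +_) (∑-comm (λ i j → χ< j i * f i j)) ⟩
  ∑[ i < n ] ∑[ j < n ] (χ< i j * f i j) + ∑[ i < n ] ∑[ j < n ] (χ< i j * f j i)
    ≡⟨ sym (∑-distrib-+ (λ i → ∑[ j < n ] (χ< i j * f i j)) (λ i → ∑[ j < n ] (χ< i j * f j i))) ⟩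
  ∑[ i < n ] (∑[ j < n ] (χ< i j * f i j) + ∑[ j < n ] (χ< i j * f j i))
    ≡⟨ sum-cong-≗ (λ i → sym (∑-distrib-+ (λ j → χ< i j * f i j) (λ j → χ< i j * f j i))) ⟩
  ∑[ i < n ] ∑[ j < n ] (χ< i j * f i j + χ< i j * f j i)
    ≡⟨ sum-cong-≗ (λ i → sum-cong-≗ (λ j → sym (*-distribˡ-+ (χ< i j) (f i j) (f j i)))) ⟩
  ∑[ i < n ] ∑[ j < n ] (χ< i j * (f i j + f j i)) ∎
  where
  open ≤-Reasoning
  χ< : Fin n → Fin n → ℕ
  χ< i j = χ (does (i <? j))
  split-by-order : ∀ i j → f i j ≤ χ< i j * f i j + χ< j i * f i j
  split-by-order i j with <-cmp i j
  ... | tri< i<j _ _ rewrite dec-true (i <? j) i<j | *-identityˡ (f i j) = m≤m+n _ _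
  ... | tri≈ _ refl _ rewrite diag i = z≤n
  ... | tri> _ _ j<i rewrite dec-true (j <? i) j<i | *-identityˡ (f i j) = m≤n+m _ _

module _ {a} {A : Set a} where

  length-filter≡sum : ∀ {p} {P : Pred A p} (P? : Decidable P) (xs : List A) →
    L.length (filter P? xs) ≡ List.sum (map (λ x → χ (does (P? x))) xs)
  length-filter≡sum P? []       = refl
  length-filter≡sum P? (x ∷ xs) with does (P? x)
  ... | true  = cong suc (length-filter≡sum P? xs)
  ... | false = length-filter≡sum P? xs

  sum-map-filter : ∀ {p} {P : Pred A p} (P? : Decidable P) (h : A → ℕ) (xs : List A) →
    List.sum (map h (filter P? xs)) ≡ List.sum (map (λ x → χ (does (P? x)) * h x) xs)
  sum-map-filter P? h []       = refl
  sum-map-filter P? h (x ∷ xs) with does (P? x)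
  ... | true  = cong₂ _+_ (sym (+-identityʳ (h x))) (sum-map-filter P? h xs)
  ... | false = sum-map-filter P? h xs

  sum-map-concatMap : ∀ {b} {B : Set b} (h : B → ℕ) (g : A → List B) (xs : List A) →
    List.sum (map h (concatMap g xs)) ≡ List.sum (map (λ x → List.sum (map h (g x))) xs)
  sum-map-concatMap h g []       = refl
  sum-map-concatMap h g (x ∷ xs) = begin
    List.sum (map h (g x L.++ concatMap g xs))
      ≡⟨ cong List.sum (map-++ h (g x) (concatMap g xs)) ⟩
    List.sum (map h (g x) L.++ map h (concatMap g xs))
      ≡⟨ sum-++ (map h (g x)) (map h (concatMap g xs)) ⟩
    List.sum (map h (g x)) + List.sum (map h (concatMap g xs))
      ≡⟨ cong (List.sum (map h (g x)) +_) (sum-map-concatMap h g xs) ⟩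
    List.sum (map h (g x)) + List.sum (map (λ y → List.sum (map h (g y))) xs) ∎
    where open ≡-Reasoning

sum-map-tabulate : ∀ {a} {A : Set a} {n} (h : A → ℕ) (f : Fin n → A) →
  List.sum (map h (tabulate f)) ≡ ∑[ i < n ] h (f i)
sum-map-tabulate {n = zero}  h f = refl
sum-map-tabulate {n = suc n} h f = cong (h (f 0F) +_) (sum-map-tabulate h (λ i → f (1+ i)))

∉⇒lookup≡outside : ∀ {n} {x : Fin n} {p} → x ∉ p → lookup p x ≡ outside
∉⇒lookup≡outside {x = x} {p} x∉p = ¬-not (λ px≡inside → x∉p (lookup⇒[]= x p px≡inside))

∣p∣≡∑χ : ∀ {n} (p : Subset n) → ∣ p ∣ ≡ ∑[ i < n ] χ (lookup p i)
∣p∣≡∑χ V.[]            = refl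
∣p∣≡∑χ (inside V.∷ p)  = cong suc (∣p∣≡∑χ p)
∣p∣≡∑χ (outside V.∷ p) = ∣p∣≡∑χ p

x∉p⇒∣p∪⁅x⁆∣≡1+∣p∣ : ∀ {n} {x : Fin n} {p} → x ∉ p → ∣ p ∪ ⁅ x ⁆ ∣ ≡ suc ∣ p ∣
x∉p⇒∣p∪⁅x⁆∣≡1+∣p∣ {x = 0F}   {inside  V.∷ p} x∉p = contradiction here x∉p
x∉p⇒∣p∪⁅x⁆∣≡1+∣p∣ {x = 0F}   {outside V.∷ p} x∉p = cong (suc ∘ ∣_∣) (∪-identityʳ p)
x∉p⇒∣p∪⁅x⁆∣≡1+∣p∣ {x = 1+ x} {inside  V.∷ p} x∉p = cong suc (x∉p⇒∣p∪⁅x⁆∣≡1+∣p∣ (x∉p ∘ there))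
x∉p⇒∣p∪⁅x⁆∣≡1+∣p∣ {x = 1+ x} {outside V.∷ p} x∉p = x∉p⇒∣p∪⁅x⁆∣≡1+∣p∣ (x∉p ∘ there)

extend-to-size : ∀ {n} {p : Subset n} {k} → ∣ p ∣ ≤ k → k ≤ n → ∃[ q ] p ⊆ q × ∣ q ∣ ≡ k
extend-to-size {k = zero}  ∣p∣≤0 _ = _ , id , n≤0⇒n≡0 ∣p∣≤0
extend-to-size {n} {p} {suc k} ∣p∣≤1+k 1+k≤n with m≤n⇒m<n∨m≡n ∣p∣≤1+k
... | inj₂ ∣p∣≡1+k      = p , id , ∣p∣≡1+k
... | inj₁ (s≤s ∣p∣≤k) with extend-to-size ∣p∣≤k (<⇒≤ 1+k≤n)
...   | q , p⊆q , ∣q∣≡k with any? (λ x → ¬? (x ∈? q))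
...     | yes (x , x∉q) =
  q ∪ ⁅ x ⁆ , (λ y∈p → p⊆p∪q ⁅ x ⁆ (p⊆q y∈p)) , trans (x∉p⇒∣p∪⁅x⁆∣≡1+∣p∣ x∉q) (cong suc ∣q∣≡k)
...     | no ∄x∉q = contradiction n≤k (<⇒≱ 1+k≤n)
  where
  ⊤⊆q : ⊤ ⊆ q
  ⊤⊆q {x} _ = decidable-stable (x ∈? q) (λ x∉q → ∄x∉q (x , x∉q))
  n≤k : n ≤ k
  n≤k = ≤-trans (≤-reflexive (sym (∣⊤∣≡n n))) (≤-trans (p⊆q⇒∣p∣≤∣q∣ ⊤⊆q) (≤-reflexive ∣q∣≡k))

module _ {n} (G : Graph n) where

  degree≡∑ : ∀ u → degree G u ≡ ∑[ v < n ] χ (adj G u v)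
  degree≡∑ u = trans (length-filter≡sum (λ v → T? (adj G u v)) (allFin n))
                     (sum-map-tabulate (λ v → χ (adj G u v)) id)

  cutSize≡∑ : ∀ S → cutSize G S ≡
    ∑[ u < n ] ∑[ v < n ] (χ (does (u <? v)) * χ (adj G u v ∧ (lookup S u xor lookup S v)))
  cutSize≡∑ S = begin
    cutSize G S
      ≡⟨ length-filter≡sum _ (orderedPairs n) ⟩
    List.sum (map c (concatMap pairsFrom (allFin n)))
      ≡⟨ sum-map-concatMap c pairsFrom (allFin n) ⟩
    List.sum (map (λ u → List.sum (map c (pairsFrom u))) (allFin n))
      ≡⟨ sum-map-tabulate (λ u → List.sum (map c (pairsFrom u))) id ⟩
    ∑[ u < n ] List.sum (map c (pairsFrom u))
      ≡⟨ sum-cong-≗ row ⟩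
    ∑[ u < n ] ∑[ v < n ] (χ (does (u <? v)) * c (u , v)) ∎
    where
    open ≡-Reasoning
    c : Fin n × Fin n → ℕ
    c (u , v) = χ (adj G u v ∧ (lookup S u xor lookup S v))
    pairsFrom : Fin n → List (Fin n × Fin n)
    pairsFrom u = map (u ,_) (filter (u <?_) (allFin n))
    row : ∀ u → List.sum (map c (pairsFrom u)) ≡ ∑[ v < n ] (χ (does (u <? v)) * c (u , v))
    row u = begin
      List.sum (map c (pairsFrom u))
        ≡⟨ cong List.sum (sym (map-∘ (filter (u <?_) (allFin n)))) ⟩
      List.sum (map (λ v → c (u , v)) (filter (u <?_) (allFin n)))
        ≡⟨ sum-map-filter (u <?_) (λ v → c (u , v)) (allFin n) ⟩
      List.sum (map (λ v → χ (does (u <? v)) * c (u , v)) (allFin n))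
        ≡⟨ sum-map-tabulate (λ v → χ (does (u <? v)) * c (u , v)) (λ v → v) ⟩
      ∑[ v < n ] (χ (does (u <? v)) * c (u , v)) ∎

  Independent : Subset n → Set
  Independent S = ∀ {u v} → u ∈ S → v ∈ S → adj G u v ≡ false

  HasNeighbourIn : Subset n → Fin n → Set
  HasNeighbourIn S v = ∃[ u ] u ∈ S × adj G u v ≡ true

  hasNeighbourIn? : ∀ S → Decidable (HasNeighbourIn S)
  hasNeighbourIn? S v = any? (λ u → (u ∈? S) ×-dec (adj G u v ≟ᵇ true))

  Dominating : Subset n → Set
  Dominating S = ∀ {v} → v ∉ S → HasNeighbourIn S v

  crossing : Subset n → Fin n → Fin n → ℕ
  crossing S u v = χ (lookup S u ∧ not (lookup S v) ∧ adj G u v)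

  outEdges : Subset n → ℕ
  outEdges S = ∑[ u < n ] ∑[ v < n ] crossing S u v

  outEdges≤cutSize : ∀ S → outEdges S ≤ cutSize G S
  outEdges≤cutSize S = begin
    outEdges S
      ≤⟨ ∑∑≤∑∑-upperTriangle (crossing S) crossing-diag ⟩
    ∑[ u < n ] ∑[ v < n ] (χ (does (u <? v)) * (crossing S u v + crossing S v u))
      ≡⟨ sum-cong-≗ (λ u → sum-cong-≗ (λ v → cong (χ (does (u <? v)) *_) (crossing-sum u v))) ⟩
    ∑[ u < n ] ∑[ v < n ] (χ (does (u <? v)) * χ (adj G u v ∧ (lookup S u xor lookup S v)))
      ≡⟨ cutSize≡∑ S ⟨
    cutSize G S ∎
    where
    open ≤-Reasoning
    crossing-diag : ∀ u → crossing S u u ≡ 0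
    crossing-diag u with lookup S u
    ... | true  = refl
    ... | false = refl
    crossing-sum : ∀ u v →
      crossing S u v + crossing S v u ≡ χ (adj G u v ∧ (lookup S u xor lookup S v))
    crossing-sum u v rewrite symmetric G v u = χ-cut (lookup S u) (lookup S v) (adj G u v)

  crossing-out : ∀ {S u v} → u ∈ S → v ∉ S → adj G u v ≡ true → crossing S u v ≡ 1
  crossing-out u∈S v∉S uv rewrite []=⇒lookup u∈S | ∉⇒lookup≡outside v∉S | uv = refl

  neighbour≤crossing : ∀ {S u} → Independent S → u ∈ S → ∀ v → χ (adj G u v) ≤ crossing S u v
  neighbour≤crossing {S} indep u∈S v with v ∈? S
  ... | yes v∈S rewrite indep u∈S v∈S = z≤n
  ... | no v∉S rewrite []=⇒lookup u∈S | ∉⇒lookup≡outside v∉S = ≤-refl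

  r*∣S∣≤outEdges : ∀ {r S} → (∀ v → r ≤ degree G v) → Independent S → r * ∣ S ∣ ≤ outEdges S
  r*∣S∣≤outEdges {r} {S} r≤deg indep = begin
    r * ∣ S ∣                              ≡⟨ cong (r *_) (∣p∣≡∑χ S) ⟩
    r * ∑[ u < n ] χ (lookup S u)          ≡⟨ *-distribˡ-sum r (λ u → χ (lookup S u)) ⟩
    ∑[ u < n ] (r * χ (lookup S u))        ≤⟨ ∑-mono-≤ row ⟩
    outEdges S                             ∎
    where
    open ≤-Reasoning
    row : ∀ u → r * χ (lookup S u) ≤ ∑[ v < n ] crossing S u v
    row u with u ∈? S
    ... | no u∉S rewrite ∉⇒lookup≡outside u∉S | *-zeroʳ r = z≤n
    ... | yes u∈S = begin
      r * χ (lookup S u)              ≡⟨ cong (λ b → r * χ b) ([]=⇒lookup u∈S) ⟩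
      r * 1                           ≡⟨ *-identityʳ r ⟩
      r                               ≤⟨ r≤deg u ⟩
      degree G u                      ≡⟨ degree≡∑ u ⟩
      ∑[ v < n ] χ (adj G u v)        ≤⟨ ∑-mono-≤ (neighbour≤crossing indep u∈S) ⟩
      ∑[ v < n ] crossing S u v       ∎

  n∸∣S∣≤outEdges : ∀ {S} → Dominating S → n ∸ ∣ S ∣ ≤ outEdges S
  n∸∣S∣≤outEdges {S} dom = begin
    n ∸ ∣ S ∣                               ≡⟨ ∣∁p∣≡n∸∣p∣ S ⟨
    ∣ ∁ S ∣                                 ≡⟨ ∣p∣≡∑χ (∁ S) ⟩
    ∑[ v < n ] χ (lookup (∁ S) v)           ≤⟨ ∑-mono-≤ column ⟩
    ∑[ v < n ] ∑[ u < n ] crossing S u v    ≡⟨ ∑-comm (crossing S) ⟨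
    outEdges S                              ∎
    where
    open ≤-Reasoning
    column : ∀ v → χ (lookup (∁ S) v) ≤ ∑[ u < n ] crossing S u v
    column v with v ∈? S
    ... | yes v∈S = ≤-trans (≤-reflexive (cong χ v∉∁S)) z≤n
      where
      v∉∁S : lookup (∁ S) v ≡ outside
      v∉∁S = trans (lookup-map v not S) (cong not ([]=⇒lookup v∈S))
    ... | no v∉S with dom v∉S
    ...   | u , u∈S , uv = begin
      χ (lookup (∁ S) v)              ≤⟨ χ≤1 (lookup (∁ S) v) ⟩
      1                               ≡⟨ crossing-out u∈S v∉S uv ⟨
      crossing S u v                  ≤⟨ term≤sum (λ w → crossing S w v) u ⟩
      ∑[ w < n ] crossing S w v       ∎


  ¬HasNeighbourIn⇒¬adj : ∀ {S u v} → ¬ HasNeighbourIn S v → u ∈ S → adj G u v ≡ false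
  ¬HasNeighbourIn⇒¬adj noNb u∈S = ¬-not (λ uv → noNb (_ , u∈S , uv))

  Independent-∪⁅⁆ : ∀ {S v} → Independent S → ¬ HasNeighbourIn S v → Independent (S ∪ ⁅ v ⁆)
  Independent-∪⁅⁆ {S} {v} indep noNb {a} {b} a∈ b∈ with x∈p∪q⁻ S ⁅ v ⁆ a∈ | x∈p∪q⁻ S ⁅ v ⁆ b∈
  ... | inj₁ a∈S | inj₁ b∈S = indep a∈S b∈S
  ... | inj₁ a∈S | inj₂ b∈⁅v⁆ rewrite x∈⁅y⁆⇒x≡y v b∈⁅v⁆ = ¬HasNeighbourIn⇒¬adj noNb a∈S
  ... | inj₂ a∈⁅v⁆ | inj₁ b∈S rewrite x∈⁅y⁆⇒x≡y v a∈⁅v⁆ =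
    trans (symmetric G v b) (¬HasNeighbourIn⇒¬adj noNb b∈S)
  ... | inj₂ a∈⁅v⁆ | inj₂ b∈⁅v⁆ rewrite x∈⁅y⁆⇒x≡y v a∈⁅v⁆ | x∈⁅y⁆⇒x≡y v b∈⁅v⁆ = loopless G v

  Dominating-⊆ : ∀ {S T} → S ⊆ T → Dominating S → Dominating T
  Dominating-⊆ S⊆T dom v∉T with dom (λ v∈S → v∉T (S⊆T v∈S))
  ... | u , u∈S , uv = u , S⊆T u∈S , uv

  independent-or-dominating : ∀ k →
    (∃[ S ] Independent S × ∣ S ∣ ≡ k) ⊎ (∃[ S ] Dominating S × ∣ S ∣ ≤ k)
  independent-or-dominating zero = inj₁ (⊥ , (λ u∈⊥ _ → contradiction u∈⊥ ∉⊥) , ∣⊥∣≡0 n)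
  independent-or-dominating (suc k) with independent-or-dominating k
  ... | inj₂ (S , dom , ∣S∣≤k) = inj₂ (S , dom , m≤n⇒m≤1+n ∣S∣≤k)
  ... | inj₁ (S , indep , ∣S∣≡k) with any? (λ v → ¬? (v ∈? S) ×-dec ¬? (hasNeighbourIn? S v))
  ...   | yes (v , v∉S , noNb) =
    inj₁ (S ∪ ⁅ v ⁆ , Independent-∪⁅⁆ indep noNb , trans (x∉p⇒∣p∪⁅x⁆∣≡1+∣p∣ v∉S) (cong suc ∣S∣≡k))
  ...   | no ∄addable = inj₂ (S , dom , m≤n⇒m≤1+n (≤-reflexive ∣S∣≡k))
    where
    dom : Dominating S
    dom {v} v∉S = decidable-stable (hasNeighbourIn? S v) (λ noNb → ∄addable (v , v∉S , noNb))

lemma13 : ∀ (n : ℕ) (G : Graph n) (r k : ℕ) → HasMinDegree G r → k ≤ n →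
            OptAtLeast G k ((n ∸ k) ⊓ (r * k))
lemma13 n G r k (r≤deg , _) k≤n with independent-or-dominating G k
... | inj₁ (S , indep , ∣S∣≡k) = S , ∣S∣≡k , (begin
  (n ∸ k) ⊓ (r * k)   ≤⟨ m⊓n≤n (n ∸ k) (r * k) ⟩
  r * k               ≡⟨ cong (r *_) ∣S∣≡k ⟨
  r * ∣ S ∣           ≤⟨ r*∣S∣≤outEdges G r≤deg indep ⟩
  outEdges G S        ≤⟨ outEdges≤cutSize G S ⟩
  cutSize G S         ∎)
  where open ≤-Reasoning
... | inj₂ (D , dom , ∣D∣≤k) with extend-to-size ∣D∣≤k k≤n
...   | T , D⊆T , ∣T∣≡k = T , ∣T∣≡k , (begin
  (n ∸ k) ⊓ (r * k)   ≤⟨ m⊓n≤m (n ∸ k) (r * k) ⟩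
  n ∸ k               ≡⟨ cong (n ∸_) ∣T∣≡k ⟨
  n ∸ ∣ T ∣           ≤⟨ n∸∣S∣≤outEdges G (Dominating-⊆ G D⊆T dom) ⟩
  outEdges G T        ≤⟨ outEdges≤cutSize G T ⟩
  cutSize G T         ∎)
  where open ≤-Reasoning
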